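{- Let $p\geq 3$ be odd and let $G=(V,E)$ be a $(p,2)$-flex-connected graph. Let $\mathcal{F}$ be the family of violated sets of $G$, let $\mathcal{F}_1\subseteq\mathcal{F}$ be the family of violated sets $A$ such that either $A$ crosses no violated set or $A$ amenably crosses some violated set, and let $\mathcal{F}_2=\mathcal{F}\setminus\mathcal{F}_1$. Then $\mathcal{F}_2$ is an uncrossable family.
   Context: $G=(V,E)$ is a finite graph (parallel edges allowed) whose edge set is partitioned into safe and unsafe edges; $\mathcal{U}$ is the set of unsafe edges. For $S\subseteq V$, $\delta(S)$ is the set of edges with exactly one endpoint in $S$; for disjoint $X,Y\subseteq V$, $E(X,Y)$ is the set of edges with one endpoint in $X$ and the other in $Y$. $G$ is $(p,2)$-flex-connected if for every $F\subseteq\mathcal{U}$ with $|F|\leq 2$ the graph $(V,E\setminus F)$ is $p$-edge-connected. A set $S\subseteq V$ is violated if $|\delta(S)|=p+2$ and $\delta(S)$ contains at least $3$ unsafe edges. Two sets $A,B\subseteq V$ cross if $A\setminus B$, $A\cap B$, $B\setminus A$, $V\setminus(A\cup B)$ are all nonempty. $A$ amenably crosses $B$ if $A$ crosses $B$ and at least one of the edge sets $E(A\cap B, B\setminus A)$ and $E(A\setminus B, V\setminus(A\cup B))$ contains no unsafe edge. A family $\mathcal{H}\subseteq 2^V$ is uncrossable if for all $A,B\in\mathcal{H}$, either ($A\cup B\in\mathcal{H}$ and $A\cap B\in\mathcal{H}$) or ($A\setminus B\in\mathcal{H}$ and $B\setminus A\in\mathcal{H}$). -}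

module Defs where

open import Data.Nat using (ℕ; _+_; _≤_; _%_)
open import Data.Bool using (Bool; true; false; _∧_; _∨_; _xor_)
open import Data.Fin using (Fin)
open import Data.Fin.Subset using (Subset; _∩_; _∪_; _─_; ∁; _⊆_; ∣_∣; Nonempty; Empty)
open import Data.Vec using (lookup; tabulate)
open import Data.Product using (_×_; Σ; proj₁; proj₂)
open import Data.Sum using (_⊎_)
open import Relation.Binary.PropositionalEquality using (_≡_)
open import Relation.Nullary using (¬_)

-- Parallel edges (and, harmlessly, loops) are allowed.
record Graph (n m : ℕ) : Set where
  field
    src    : Fin m → Fin n
    tgt    : Fin m → Fin n
    unsafe : Fin m → Bool

open Graph public

module _ {n m : ℕ} (G : Graph n m) where

  UnsafeSet : Subset m
  UnsafeSet = tabulate (unsafe G)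

  δ : Subset n → Subset m
  δ S = tabulate λ e → lookup S (src G e) xor lookup S (tgt G e)

  Ebetween : Subset n → Subset n → Subset m
  Ebetween X Y = tabulate λ e →
    (lookup X (src G e) ∧ lookup Y (tgt G e)) ∨ (lookup Y (src G e) ∧ lookup X (tgt G e))

  EdgeConnectedWithout : ℕ → Subset m → Set
  EdgeConnectedWithout p F =
    (S : Subset n) → Nonempty S → Nonempty (∁ S) → p ≤ ∣ δ S ─ F ∣

  FlexConnected : ℕ → Set
  FlexConnected p = (F : Subset m) → F ⊆ UnsafeSet → ∣ F ∣ ≤ 2 → EdgeConnectedWithout p F

  Violated : ℕ → Subset n → Set
  Violated p S = (∣ δ S ∣ ≡ p + 2) × (3 ≤ ∣ δ S ∩ UnsafeSet ∣)

  Cross : Subset n → Subset n → Set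
  Cross A B = Nonempty (A ─ B) × Nonempty (A ∩ B) × Nonempty (B ─ A) × Nonempty (∁ (A ∪ B))

  AmenablyCross : Subset n → Subset n → Set
  AmenablyCross A B = Cross A B ×
    (Empty (Ebetween (A ∩ B) (B ─ A) ∩ UnsafeSet) ⊎ Empty (Ebetween (A ─ B) (∁ (A ∪ B)) ∩ UnsafeSet))

  F₁ : ℕ → Subset n → Set
  F₁ p A = Violated p A ×
    (((B : Subset n) → Violated p B → ¬ Cross A B)
     ⊎ Σ (Subset n) (λ B → Violated p B × AmenablyCross A B))

  F₂ : ℕ → Subset n → Set
  F₂ p A = Violated p A × ¬ F₁ p A

Uncrossable : {n : ℕ} → (Subset n → Set) → Set
Uncrossable {n} H = (A B : Subset n) → H A → H B →
  (H (A ∪ B) × H (A ∩ B)) ⊎ (H (A ─ B) × H (B ─ A))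

module Submission where

-- Two members A, B of ℱ₂ never cross. Otherwise neither crosses the other
-- amenably, so each quadrant A ─ B, A ∩ B, B ─ A, ∁ (A ∪ B) has two distinct
-- unsafe edges on its boundary, and deleting them shows |δ Q| ≥ p + 2 for every
-- quadrant Q. Counting the cuts of the two quadrants outside B against δ B gives
-- 2 |E(A ─ B, ∁ (A ∪ B))| ≥ p + 2, the two quadrants inside B give
-- 2 |E(A ∩ B, B ─ A)| ≥ p + 2, yet both edge sets are disjoint parts of δ A, of
-- size p + 2; since p + 2 is odd, this is impossible. Moreover ℱ₂ is closed under
-- complement, as δ (∁ S) = δ S and ∁ S crosses C (amenably) exactly when S does.
-- A complement-closed family without crossing pairs is uncrossable: for
-- non-crossing A, B one quadrant is empty, and then the four required sets are
-- A, B or their complements.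

open import Defs
open import Data.Bool using (Bool; true; false; _∧_; _∨_; _xor_; not; T)
open import Data.Bool.Properties using (T-∧; ∧-zeroʳ; ∧-identityʳ; not-involutive; xor-annihilates-not)
open import Data.Empty using (⊥; ⊥-elim)
open import Data.Unit using (tt)
open import Data.Fin using (Fin; zero; suc)
open import Data.Fin.Subset using (Subset; _∩_; _∪_; _─_; _-_; ∁; ⁅_⁆; _⊆_; _∈_; ∣_∣; Nonempty; Empty)
open import Data.Fin.Subset.Properties
  using ( nonempty?; ⊆-antisym; x∈p∩q⁺; x∈p∩q⁻; x∈p∪q⁻; ∩-comm; ∪-comm; x∈⁅y⁆⇒x≡y; ∣⁅x⁆∣≡1; ∣p∣≤∣x∷p∣
        ; p─q─r≡p─q∪r; x∈p∧x≢y⇒x∈p-y; x∈p⇒∣p-x∣<∣p∣)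
open import Data.List using (List; []; _∷_; map)
open import Data.Nat.ListAction using (sum)
open import Data.Nat using (ℕ; zero; suc; _+_; _*_; _≤_; _<_; _≤ᵇ_; _%_; _/_; z≤n; s≤s)
open import Data.Nat.Properties
  using ( ≤-refl; ≤-trans; ≤-reflexive; <-irrefl; ≤∧≢⇒<; ≤ᵇ⇒≤; +-comm; +-suc; +-identityʳ; +-mono-≤; +-monoˡ-≤
        ; +-monoʳ-≤; +-mono-<; +-cancelˡ-≤; m≤m+n; m≤n+m; *-comm; *-distribˡ-+; *-monoʳ-≤; even≢odd
        ; +-commutativeSemigroup; module ≤-Reasoning)
open import Algebra.Properties.CommutativeSemigroup +-commutativeSemigroup using (interchange)
open import Data.Nat.DivMod using (m≡m%n+[m/n]*n; [m+kn]%n≡m%n)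
open import Data.Product using (_×_; _,_; proj₁; proj₂)
open import Data.Sum using (_⊎_; inj₁; inj₂)
open import Data.Vec using (_∷_; []; lookup; tabulate)
open import Data.Vec.Properties
  using (lookup-zipWith; lookup-map; lookup∘tabulate; tabulate∘lookup; tabulate-cong; []=⇒lookup; lookup⇒[]=)
open import Function using (_∘_; Equivalence)
open import Relation.Binary.PropositionalEquality
  using (_≡_; _≢_; refl; sym; trans; cong; cong₂; subst; subst₂; module ≡-Reasoning)
open import Relation.Nullary using (¬_; Dec; yes; no)
open import Relation.Nullary.Decidable using (decidable-stable)

𝟙 : Bool → ℕ
𝟙 true  = 1
𝟙 false = 0

∑ : ∀ {k} → (Fin k → ℕ) → ℕ
∑ {zero}  f = 0
∑ {suc k} f = f zero + ∑ (f ∘ suc)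

∑-mono-≤ : ∀ {k} {f g : Fin k → ℕ} → (∀ i → f i ≤ g i) → ∑ f ≤ ∑ g
∑-mono-≤ {zero}  f≤g = z≤n
∑-mono-≤ {suc k} f≤g = +-mono-≤ (f≤g zero) (∑-mono-≤ (f≤g ∘ suc))

∑-zero : ∀ k → ∑ {k} (λ _ → 0) ≡ 0
∑-zero zero    = refl
∑-zero (suc k) = ∑-zero k

∑-distrib-+ : ∀ {k} (f g : Fin k → ℕ) → ∑ (λ i → f i + g i) ≡ ∑ f + ∑ g
∑-distrib-+ {zero}  f g = refl
∑-distrib-+ {suc k} f g =
  trans (cong (f zero + g zero +_) (∑-distrib-+ (f ∘ suc) (g ∘ suc)))
        (interchange (f zero) (g zero) (∑ (f ∘ suc)) (∑ (g ∘ suc)))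

∣∣≡∑𝟙 : ∀ {k} (p : Subset k) → ∣ p ∣ ≡ ∑ (𝟙 ∘ lookup p)
∣∣≡∑𝟙 []          = refl
∣∣≡∑𝟙 (true ∷ p)  = cong suc (∣∣≡∑𝟙 p)
∣∣≡∑𝟙 (false ∷ p) = ∣∣≡∑𝟙 p

∣p∪q∣≤∣p∣+∣q∣ : ∀ {k} (p q : Subset k) → ∣ p ∪ q ∣ ≤ ∣ p ∣ + ∣ q ∣
∣p∪q∣≤∣p∣+∣q∣ []          []          = z≤n
∣p∪q∣≤∣p∣+∣q∣ (true ∷ p)  (y ∷ q)     =
  s≤s (≤-trans (∣p∪q∣≤∣p∣+∣q∣ p q) (+-monoʳ-≤ ∣ p ∣ (∣p∣≤∣x∷p∣ y q)))
∣p∪q∣≤∣p∣+∣q∣ (false ∷ p) (true ∷ q)  =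
  ≤-trans (s≤s (∣p∪q∣≤∣p∣+∣q∣ p q)) (≤-reflexive (sym (+-suc ∣ p ∣ ∣ q ∣)))
∣p∪q∣≤∣p∣+∣q∣ (false ∷ p) (false ∷ q) = ∣p∪q∣≤∣p∣+∣q∣ p q

module _ {k : ℕ} where

  multiplicity : List (Subset k) → Fin k → ℕ
  multiplicity ps i = sum (map (λ q → 𝟙 (lookup q i)) ps)

  ∑∣_∣ : List (Subset k) → ℕ
  ∑∣ ps ∣ = sum (map ∣_∣ ps)

  infix 4 _⊑_
  record _⊑_ (ps qs : List (Subset k)) : Set where
    constructor pointwise
    field multiplicity-≤ : ∀ i → multiplicity ps i ≤ multiplicity qs i

  open _⊑_ public

  ∑∣∣≡∑multiplicity : ∀ ps → ∑∣ ps ∣ ≡ ∑ (multiplicity ps)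
  ∑∣∣≡∑multiplicity []       = sym (∑-zero k)
  ∑∣∣≡∑multiplicity (q ∷ ps) =
    trans (cong₂ _+_ (∣∣≡∑𝟙 q) (∑∣∣≡∑multiplicity ps))
          (sym (∑-distrib-+ (𝟙 ∘ lookup q) (multiplicity ps)))

  ⊑⇒∑∣∣≤ : ∀ {ps qs} → ps ⊑ qs → ∑∣ ps ∣ ≤ ∑∣ qs ∣
  ⊑⇒∑∣∣≤ {ps} {qs} ps⊑qs =
    subst₂ _≤_ (sym (∑∣∣≡∑multiplicity ps)) (sym (∑∣∣≡∑multiplicity qs)) (∑-mono-≤ (multiplicity-≤ ps⊑qs))

  ∑∣∣-pair : ∀ p q → ∑∣ p ∷ q ∷ [] ∣ ≡ ∣ p ∣ + ∣ q ∣
  ∑∣∣-pair p q = cong (∣ p ∣ +_) (+-identityʳ ∣ q ∣)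

  multiplicity-map : ∀ {X : Set} (f : X → Subset k) (g : X → Bool) xs i → (∀ x → lookup (f x) i ≡ g x) →
                     multiplicity (map f xs) i ≡ sum (map (𝟙 ∘ g) xs)
  multiplicity-map f g []       i f≡g = refl
  multiplicity-map f g (x ∷ xs) i f≡g = cong₂ _+_ (cong 𝟙 (f≡g x)) (multiplicity-map f g xs i f≡g)

  private
    𝟙-∈ : ∀ {x} {q : Subset k} → x ∈ q → 𝟙 (lookup q x) ≡ 1
    𝟙-∈ x∈q = cong 𝟙 ([]=⇒lookup x∈q)

    1≤𝟙⇒∈ : ∀ {x} (q : Subset k) → 1 ≤ 𝟙 (lookup q x) → x ∈ q
    1≤𝟙⇒∈ {x} q 1≤𝟙 with lookup q x in eq
    ... | true = lookup⇒[]= x q eq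

    𝟙≤1 : ∀ b → 𝟙 b ≤ 1
    𝟙≤1 true  = ≤-refl
    𝟙≤1 false = z≤n

  open ≤-Reasoning

  ⊑-singleton⇒⊆ : ∀ {p q} → (p ∷ []) ⊑ (q ∷ []) → p ⊆ q
  ⊑-singleton⇒⊆ {p} {q} p⊑q {x} x∈p = 1≤𝟙⇒∈ q (begin
    1                         ≡⟨ 𝟙-∈ x∈p ⟨
    𝟙 (lookup p x)            ≤⟨ m≤m+n _ 0 ⟩
    multiplicity (p ∷ []) x   ≤⟨ multiplicity-≤ p⊑q x ⟩
    𝟙 (lookup q x) + 0        ≡⟨ +-identityʳ _ ⟩
    𝟙 (lookup q x)            ∎)

  ⊑-pair⇒⊆ˡ : ∀ {p q r} → (p ∷ q ∷ []) ⊑ (r ∷ []) → p ⊆ r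
  ⊑-pair⇒⊆ˡ {p} {q} {r} pq⊑r {x} x∈p = 1≤𝟙⇒∈ r (begin
    1                           ≡⟨ 𝟙-∈ x∈p ⟨
    𝟙 (lookup p x)              ≤⟨ m≤m+n _ _ ⟩
    multiplicity (p ∷ q ∷ []) x ≤⟨ multiplicity-≤ pq⊑r x ⟩
    𝟙 (lookup r x) + 0          ≡⟨ +-identityʳ _ ⟩
    𝟙 (lookup r x)              ∎)

  ⊑-pair⇒⊆ʳ : ∀ {p q r} → (p ∷ q ∷ []) ⊑ (r ∷ []) → q ⊆ r
  ⊑-pair⇒⊆ʳ {p} {q} {r} pq⊑r {x} x∈q = 1≤𝟙⇒∈ r (begin
    1                           ≡⟨ 𝟙-∈ x∈q ⟨
    𝟙 (lookup q x)              ≤⟨ m≤m+n _ 0 ⟩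
    𝟙 (lookup q x) + 0          ≤⟨ m≤n+m _ (𝟙 (lookup p x)) ⟩
    multiplicity (p ∷ q ∷ []) x ≤⟨ multiplicity-≤ pq⊑r x ⟩
    𝟙 (lookup r x) + 0          ≡⟨ +-identityʳ _ ⟩
    𝟙 (lookup r x)              ∎)

  ⊑-pair⇒disjoint : ∀ {p q r x} → (p ∷ q ∷ []) ⊑ (r ∷ []) → x ∈ p → x ∈ q → ⊥
  ⊑-pair⇒disjoint {p} {q} {r} {x} pq⊑r x∈p x∈q = <-irrefl refl (begin-strict
    1                           <⟨ s≤s (s≤s z≤n) ⟩
    2                           ≡⟨ cong₂ (λ a b → a + (b + 0)) (𝟙-∈ x∈p) (𝟙-∈ x∈q) ⟨
    multiplicity (p ∷ q ∷ []) x ≤⟨ multiplicity-≤ pq⊑r x ⟩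
    𝟙 (lookup r x) + 0          ≡⟨ +-identityʳ _ ⟩
    𝟙 (lookup r x)              ≤⟨ 𝟙≤1 _ ⟩
    1                           ∎)

-- Every set in the argument is a Boolean combination of two sets A and B, and
-- whether an edge lies in δ or E(·,·) of such sets depends only on whether its
-- two endpoints lie in A and in B; so inclusions and counting inequalities
-- between these sets are decided by truth tables over those four bits.

infixr 7 _∩ᵗ_
infixr 6 _∪ᵗ_
infixl 5 _─ᵗ_

data SetTerm : Set where
  𝔸 𝔹           : SetTerm
  ∁ᵗ             : SetTerm → SetTerm
  _∩ᵗ_ _∪ᵗ_ _─ᵗ_ : SetTerm → SetTerm → SetTerm

eval : SetTerm → Bool → Bool → Bool
eval 𝔸        a b = a
eval 𝔹        a b = b
eval (∁ᵗ s)   a b = not (eval s a b)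
eval (s ∩ᵗ t) a b = eval s a b ∧ eval t a b
eval (s ∪ᵗ t) a b = eval s a b ∨ eval t a b
eval (s ─ᵗ t) a b = eval s a b ∧ not (eval t a b)

⊆-holds : SetTerm → SetTerm → Bool → Bool → Bool
⊆-holds s t a b = not (eval s a b) ∨ eval t a b

≡-outside-holds : SetTerm → SetTerm → SetTerm → Bool → Bool → Bool
≡-outside-holds r s t a b = eval r a b ∨ not (eval s a b xor eval t a b)

data CutTerm : Set where
  δᵗ : SetTerm → CutTerm
  Eᵗ : SetTerm → SetTerm → CutTerm

-- a, b: the source lies in A, in B; a′, b′: the same for the target
evalᶜ : CutTerm → Bool → Bool → Bool → Bool → Bool
evalᶜ (δᵗ s)   a b a′ b′ = eval s a b xor eval s a′ b′
evalᶜ (Eᵗ s t) a b a′ b′ = (eval s a b ∧ eval t a′ b′) ∨ (eval t a b ∧ eval s a′ b′)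

countᶜ : List CutTerm → Bool → Bool → Bool → Bool → ℕ
countᶜ cs a b a′ b′ = sum (map (λ c → 𝟙 (evalᶜ c a b a′ b′)) cs)

⊑-holds : List CutTerm → List CutTerm → Bool → Bool → Bool → Bool → Bool
⊑-holds cs ds a b a′ b′ = countᶜ cs a b a′ b′ ≤ᵇ countᶜ ds a b a′ b′

∀ᵇ : (Bool → Bool) → Bool
∀ᵇ f = f true ∧ f false

∀ᵇ-sound : ∀ f → T (∀ᵇ f) → ∀ b → T (f b)
∀ᵇ-sound f t true  = proj₁ (Equivalence.to T-∧ t)
∀ᵇ-sound f t false = proj₂ (Equivalence.to T-∧ t)

valid₂ : (Bool → Bool → Bool) → Bool
valid₂ φ = ∀ᵇ λ a → ∀ᵇ (φ a)

valid₂-sound : ∀ φ → T (valid₂ φ) → ∀ a b → T (φ a b)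
valid₂-sound φ t a = ∀ᵇ-sound (φ a) (∀ᵇ-sound (λ a → ∀ᵇ (φ a)) t a)

valid₄ : (Bool → Bool → Bool → Bool → Bool) → Bool
valid₄ φ = valid₂ λ a b → valid₂ (φ a b)

valid₄-sound : ∀ φ → T (valid₄ φ) → ∀ a b a′ b′ → T (φ a b a′ b′)
valid₄-sound φ t a b = valid₂-sound (φ a b) (valid₂-sound (λ a b → valid₂ (φ a b)) t a b)

lookup-─ : ∀ {k} (p q : Subset k) i → lookup (p ─ q) i ≡ lookup p i ∧ not (lookup q i)
lookup-─ (x ∷ p) (true ∷ q)  zero    = sym (∧-zeroʳ x)
lookup-─ (x ∷ p) (false ∷ q) zero    = sym (∧-identityʳ x)
lookup-─ (x ∷ p) (y ∷ q)     (suc i) = lookup-─ p q i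

module Venn {n : ℕ} (A B : Subset n) where

  ⟦_⟧ : SetTerm → Subset n
  ⟦ 𝔸 ⟧      = A
  ⟦ 𝔹 ⟧      = B
  ⟦ ∁ᵗ s ⟧   = ∁ ⟦ s ⟧
  ⟦ s ∩ᵗ t ⟧ = ⟦ s ⟧ ∩ ⟦ t ⟧
  ⟦ s ∪ᵗ t ⟧ = ⟦ s ⟧ ∪ ⟦ t ⟧
  ⟦ s ─ᵗ t ⟧ = ⟦ s ⟧ ─ ⟦ t ⟧

  eval-at : SetTerm → Fin n → Bool
  eval-at s i = eval s (lookup A i) (lookup B i)

  lookup-⟦⟧ : ∀ s i → lookup ⟦ s ⟧ i ≡ eval-at s i
  lookup-⟦⟧ 𝔸        i = refl
  lookup-⟦⟧ 𝔹        i = refl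
  lookup-⟦⟧ (∁ᵗ s)   i = trans (lookup-map i not ⟦ s ⟧) (cong not (lookup-⟦⟧ s i))
  lookup-⟦⟧ (s ∩ᵗ t) i =
    trans (lookup-zipWith _∧_ i ⟦ s ⟧ ⟦ t ⟧) (cong₂ _∧_ (lookup-⟦⟧ s i) (lookup-⟦⟧ t i))
  lookup-⟦⟧ (s ∪ᵗ t) i =
    trans (lookup-zipWith _∨_ i ⟦ s ⟧ ⟦ t ⟧) (cong₂ _∨_ (lookup-⟦⟧ s i) (lookup-⟦⟧ t i))
  lookup-⟦⟧ (s ─ᵗ t) i =
    trans (lookup-─ ⟦ s ⟧ ⟦ t ⟧ i) (cong₂ (λ x y → x ∧ not y) (lookup-⟦⟧ s i) (lookup-⟦⟧ t i))

  private
    implies-sound : ∀ x y → T (not x ∨ y) → x ≡ true → y ≡ true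
    implies-sound true true _ _ = refl

    agrees-sound : ∀ r x y → T (r ∨ not (x xor y)) → r ≡ false → x ≡ y
    agrees-sound false true  true  _ _ = refl
    agrees-sound false false false _ _ = refl

  decide-⊆ : ∀ s t → T (valid₂ (⊆-holds s t)) → ⟦ s ⟧ ⊆ ⟦ t ⟧
  decide-⊆ s t table {i} i∈s = lookup⇒[]= i ⟦ t ⟧ (begin
    lookup ⟦ t ⟧ i  ≡⟨ lookup-⟦⟧ t i ⟩
    eval-at t i     ≡⟨ implies-sound _ _ (valid₂-sound (⊆-holds s t) table (lookup A i) (lookup B i))
                         (trans (sym (lookup-⟦⟧ s i)) ([]=⇒lookup i∈s)) ⟩
    true            ∎)
    where open ≡-Reasoning

  decide-≡ : ∀ r s t → Empty ⟦ r ⟧ → T (valid₂ (≡-outside-holds r s t)) →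
             ⟦ s ⟧ ≡ ⟦ t ⟧
  decide-≡ r s t r≡∅ table = begin
    ⟦ s ⟧                     ≡⟨ tabulate∘lookup ⟦ s ⟧ ⟨
    tabulate (lookup ⟦ s ⟧)   ≡⟨ tabulate-cong agree ⟩
    tabulate (lookup ⟦ t ⟧)   ≡⟨ tabulate∘lookup ⟦ t ⟧ ⟩
    ⟦ t ⟧                     ∎
    where
    open ≡-Reasoning
    r-false : ∀ i → eval-at r i ≡ false
    r-false i with eval-at r i in eq
    ... | true  = ⊥-elim (r≡∅ (i , lookup⇒[]= i ⟦ r ⟧ (trans (lookup-⟦⟧ r i) eq)))
    ... | false = refl
    agree : ∀ i → lookup ⟦ s ⟧ i ≡ lookup ⟦ t ⟧ i
    agree i = trans (lookup-⟦⟧ s i) (trans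
      (agrees-sound _ _ _ (valid₂-sound (≡-outside-holds r s t) table (lookup A i) (lookup B i)) (r-false i))
      (sym (lookup-⟦⟧ t i)))

module VennCuts {n m : ℕ} (G : Graph n m) (A B : Subset n) where

  open Venn A B public

  ⟦_⟧ᶜ : CutTerm → Subset m
  ⟦ δᵗ s ⟧ᶜ   = δ G ⟦ s ⟧
  ⟦ Eᵗ s t ⟧ᶜ = Ebetween G ⟦ s ⟧ ⟦ t ⟧

  evalᶜ-at : CutTerm → Fin m → Bool
  evalᶜ-at c e =
    evalᶜ c (lookup A (src G e)) (lookup B (src G e)) (lookup A (tgt G e)) (lookup B (tgt G e))

  lookup-⟦⟧ᶜ : ∀ c e → lookup ⟦ c ⟧ᶜ e ≡ evalᶜ-at c e
  lookup-⟦⟧ᶜ (δᵗ s) e =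
    trans (lookup∘tabulate _ e) (cong₂ _xor_ (lookup-⟦⟧ s (src G e)) (lookup-⟦⟧ s (tgt G e)))
  lookup-⟦⟧ᶜ (Eᵗ s t) e = trans (lookup∘tabulate _ e) (cong₂ _∨_
    (cong₂ _∧_ (lookup-⟦⟧ s (src G e)) (lookup-⟦⟧ t (tgt G e)))
    (cong₂ _∧_ (lookup-⟦⟧ t (src G e)) (lookup-⟦⟧ s (tgt G e))))

  decide-⊑ : ∀ cs ds → T (valid₄ (⊑-holds cs ds)) → map ⟦_⟧ᶜ cs ⊑ map ⟦_⟧ᶜ ds
  decide-⊑ cs ds table = pointwise λ e → subst₂ _≤_
    (sym (multiplicity-map ⟦_⟧ᶜ (λ c → evalᶜ-at c e) cs e (λ c → lookup-⟦⟧ᶜ c e)))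
    (sym (multiplicity-map ⟦_⟧ᶜ (λ c → evalᶜ-at c e) ds e (λ c → lookup-⟦⟧ᶜ c e)))
    (≤ᵇ⇒≤ _ _ (valid₄-sound (⊑-holds cs ds) table
      (lookup A (src G e)) (lookup B (src G e)) (lookup A (tgt G e)) (lookup B (tgt G e))))

  decide-⊆ᶜ : ∀ c d → T (valid₄ (⊑-holds (c ∷ []) (d ∷ []))) → ⟦ c ⟧ᶜ ⊆ ⟦ d ⟧ᶜ
  decide-⊆ᶜ c d table = ⊑-singleton⇒⊆ (decide-⊑ (c ∷ []) (d ∷ []) table)

Nonempty-mono : ∀ {k} {p q : Subset k} → p ⊆ q → Nonempty p → Nonempty q
Nonempty-mono p⊆q (x , x∈p) = x , p⊆q x∈p

Empty-∩-antimono : ∀ {k} {p q r : Subset k} → p ⊆ q → Empty (q ∩ r) → Empty (p ∩ r)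
Empty-∩-antimono {p = p} {r = r} p⊆q q∩r≡∅ (x , x∈p∩r) =
  q∩r≡∅ (x , x∈p∩q⁺ (p⊆q (proj₁ (x∈p∩q⁻ p r x∈p∩r)) , proj₂ (x∈p∩q⁻ p r x∈p∩r)))

∁-involutive : ∀ {k} (p : Subset k) → ∁ (∁ p) ≡ p
∁-involutive []      = refl
∁-involutive (x ∷ p) = cong₂ _∷_ (not-involutive x) (∁-involutive p)

module _ {n m : ℕ} (G : Graph n m) where

  δ-∁ : ∀ S → δ G (∁ S) ≡ δ G S
  δ-∁ S = tabulate-cong λ e →
    trans (cong₂ _xor_ (lookup-map (src G e) not S) (lookup-map (tgt G e) not S))
          (xor-annihilates-not (lookup S (src G e)) (lookup S (tgt G e)))

  Violated-cong-δ : ∀ {p} S S′ → δ G S ≡ δ G S′ → Violated G p S → Violated G p S′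
  Violated-cong-δ {p} S S′ δS≡δS′ = subst (λ D → (∣ D ∣ ≡ p + 2) × (3 ≤ ∣ D ∩ UnsafeSet G ∣)) δS≡δS′

  Cross-sym : ∀ {A B} → Cross G A B → Cross G B A
  Cross-sym {A} {B} (A─B≢∅ , A∩B≢∅ , B─A≢∅ , ∁A∪B≢∅) =
    B─A≢∅ , subst Nonempty (∩-comm A B) A∩B≢∅ , A─B≢∅ , subst (Nonempty ∘ ∁) (∪-comm A B) ∁A∪B≢∅

  Cross-∁ : ∀ {S C} → Cross G S C → Cross G (∁ S) C
  Cross-∁ {S} {C} (S─C≢∅ , S∩C≢∅ , C─S≢∅ , ∁S∪C≢∅) =
    Nonempty-mono (decide-⊆ (∁ᵗ (𝔸 ∪ᵗ 𝔹)) (∁ᵗ 𝔸 ─ᵗ 𝔹) tt) ∁S∪C≢∅ ,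
    Nonempty-mono (decide-⊆ (𝔹 ─ᵗ 𝔸) (∁ᵗ 𝔸 ∩ᵗ 𝔹) tt) C─S≢∅ ,
    Nonempty-mono (decide-⊆ (𝔸 ∩ᵗ 𝔹) (𝔹 ─ᵗ ∁ᵗ 𝔸) tt) S∩C≢∅ ,
    Nonempty-mono (decide-⊆ (𝔸 ─ᵗ 𝔹) (∁ᵗ (∁ᵗ 𝔸 ∪ᵗ 𝔹)) tt) S─C≢∅
    where open Venn S C

  AmenablyCross-∁⁻ : ∀ {S C} → AmenablyCross G (∁ S) C → AmenablyCross G S C
  AmenablyCross-∁⁻ {S} {C} (cross , inj₁ E∩U≡∅) =
    subst (λ X → Cross G X C) (∁-involutive S) (Cross-∁ cross) ,
    inj₁ (Empty-∩-antimono (decide-⊆ᶜ (Eᵗ (𝔸 ∩ᵗ 𝔹) (𝔹 ─ᵗ 𝔸)) (Eᵗ (∁ᵗ 𝔸 ∩ᵗ 𝔹) (𝔹 ─ᵗ ∁ᵗ 𝔸)) tt) E∩U≡∅)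
    where open VennCuts G S C
  AmenablyCross-∁⁻ {S} {C} (cross , inj₂ E∩U≡∅) =
    subst (λ X → Cross G X C) (∁-involutive S) (Cross-∁ cross) ,
    inj₂ (Empty-∩-antimono
      (decide-⊆ᶜ (Eᵗ (𝔸 ─ᵗ 𝔹) (∁ᵗ (𝔸 ∪ᵗ 𝔹))) (Eᵗ (∁ᵗ 𝔸 ─ᵗ 𝔹) (∁ᵗ (∁ᵗ 𝔸 ∪ᵗ 𝔹))) tt) E∩U≡∅)
    where open VennCuts G S C

  F₁-∁⁻ : ∀ {p S} → F₁ G p (∁ S) → F₁ G p S
  F₁-∁⁻ {S = S} (violated , inj₁ crosses-nothing) =
    Violated-cong-δ (∁ S) S (δ-∁ S) violated , inj₁ (λ C violatedC → crosses-nothing C violatedC ∘ Cross-∁)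
  F₁-∁⁻ {S = S} (violated , inj₂ (C , violatedC , amenable)) =
    Violated-cong-δ (∁ S) S (δ-∁ S) violated , inj₂ (C , violatedC , AmenablyCross-∁⁻ amenable)

  F₂-∁ : ∀ {p S} → F₂ G p S → F₂ G p (∁ S)
  F₂-∁ {S = S} (violated , ¬F₁) = Violated-cong-δ S (∁ S) (sym (δ-∁ S)) violated , ¬F₁ ∘ F₁-∁⁻

  noncrossing⇒uncrossable : {H : Subset n → Set} → (∀ {S} → H S → H (∁ S)) →
                            (∀ {A B} → H A → H B → ¬ Cross G A B) → Uncrossable H
  noncrossing⇒uncrossable {H} H-∁ H-noncrossing A B hA hB =
    by-quadrants (nonempty? (A ─ B)) (nonempty? (A ∩ B)) (nonempty? (B ─ A)) (nonempty? (∁ (A ∪ B)))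
    where
    open Venn A B
    by-quadrants : Dec (Nonempty (A ─ B)) → Dec (Nonempty (A ∩ B)) → Dec (Nonempty (B ─ A)) →
                   Dec (Nonempty (∁ (A ∪ B))) → (H (A ∪ B) × H (A ∩ B)) ⊎ (H (A ─ B) × H (B ─ A))
    by-quadrants (no A─B≡∅) _ _ _ = inj₁
      ( subst H (decide-≡ (𝔸 ─ᵗ 𝔹) 𝔹 (𝔸 ∪ᵗ 𝔹) A─B≡∅ tt) hB
      , subst H (decide-≡ (𝔸 ─ᵗ 𝔹) 𝔸 (𝔸 ∩ᵗ 𝔹) A─B≡∅ tt) hA)
    by-quadrants (yes _) (no A∩B≡∅) _ _ = inj₂
      ( subst H (decide-≡ (𝔸 ∩ᵗ 𝔹) 𝔸 (𝔸 ─ᵗ 𝔹) A∩B≡∅ tt) hA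
      , subst H (decide-≡ (𝔸 ∩ᵗ 𝔹) 𝔹 (𝔹 ─ᵗ 𝔸) A∩B≡∅ tt) hB)
    by-quadrants (yes _) (yes _) (no B─A≡∅) _ = inj₁
      ( subst H (decide-≡ (𝔹 ─ᵗ 𝔸) 𝔸 (𝔸 ∪ᵗ 𝔹) B─A≡∅ tt) hA
      , subst H (decide-≡ (𝔹 ─ᵗ 𝔸) 𝔹 (𝔸 ∩ᵗ 𝔹) B─A≡∅ tt) hB)
    by-quadrants (yes _) (yes _) (yes _) (no A∪B≡V) = inj₂
      ( subst H (decide-≡ (∁ᵗ (𝔸 ∪ᵗ 𝔹)) (∁ᵗ 𝔹) (𝔸 ─ᵗ 𝔹) A∪B≡V tt) (H-∁ hB)
      , subst H (decide-≡ (∁ᵗ (𝔸 ∪ᵗ 𝔹)) (∁ᵗ 𝔸) (𝔹 ─ᵗ 𝔸) A∪B≡V tt) (H-∁ hA))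
    by-quadrants (yes A─B≢∅) (yes A∩B≢∅) (yes B─A≢∅) (yes ∁A∪B≢∅) =
      ⊥-elim (H-noncrossing hA hB (A─B≢∅ , A∩B≢∅ , B─A≢∅ , ∁A∪B≢∅))

module _ {n m : ℕ} (G : Graph n m) (A B : Subset n) where

  open VennCuts G A B
  open ≤-Reasoning

  -- Quadrants are numbered 1 = A ─ B, 2 = A ∩ B, 3 = B ─ A, 4 = ∁ (A ∪ B), and
  -- Eᵢⱼ holds the edges between quadrants i and j.

  -- An edge between the two quadrants lies in both cuts; any other edge of
  -- either cut crosses δ B.
  quadrant-cuts-outside :
    ∣ δ G (∁ (A ∪ B)) ∣ + ∣ δ G (A ─ B) ∣ ≤ ∣ δ G B ∣ + 2 * ∣ Ebetween G (A ─ B) (∁ (A ∪ B)) ∣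
  quadrant-cuts-outside = begin
    ∣ δ G (∁ (A ∪ B)) ∣ + ∣ δ G (A ─ B) ∣   ≡⟨ ∑∣∣-pair (δ G (∁ (A ∪ B))) (δ G (A ─ B)) ⟨
    ∑∣ δ G (∁ (A ∪ B)) ∷ δ G (A ─ B) ∷ [] ∣ ≤⟨ ⊑⇒∑∣∣≤ cuts⊑ ⟩
    ∣ δ G B ∣ + 2 * ∣ ⟦ E₁₄ ⟧ᶜ ∣             ∎
    where
    E₁₄ = Eᵗ (𝔸 ─ᵗ 𝔹) (∁ᵗ (𝔸 ∪ᵗ 𝔹))
    cuts⊑ = decide-⊑ (δᵗ (∁ᵗ (𝔸 ∪ᵗ 𝔹)) ∷ δᵗ (𝔸 ─ᵗ 𝔹) ∷ []) (δᵗ 𝔹 ∷ E₁₄ ∷ E₁₄ ∷ []) tt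

  quadrant-cuts-inside :
    ∣ δ G (A ∩ B) ∣ + ∣ δ G (B ─ A) ∣ ≤ ∣ δ G B ∣ + 2 * ∣ Ebetween G (A ∩ B) (B ─ A) ∣
  quadrant-cuts-inside = begin
    ∣ δ G (A ∩ B) ∣ + ∣ δ G (B ─ A) ∣   ≡⟨ ∑∣∣-pair (δ G (A ∩ B)) (δ G (B ─ A)) ⟨
    ∑∣ δ G (A ∩ B) ∷ δ G (B ─ A) ∷ [] ∣ ≤⟨ ⊑⇒∑∣∣≤ cuts⊑ ⟩
    ∣ δ G B ∣ + 2 * ∣ ⟦ E₂₃ ⟧ᶜ ∣         ∎
    where
    E₂₃ = Eᵗ (𝔸 ∩ᵗ 𝔹) (𝔹 ─ᵗ 𝔸)
    cuts⊑ = decide-⊑ (δᵗ (𝔸 ∩ᵗ 𝔹) ∷ δᵗ (𝔹 ─ᵗ 𝔸) ∷ []) (δᵗ 𝔹 ∷ E₂₃ ∷ E₂₃ ∷ []) tt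

  diagonal-edges-in-δ : ∣ Ebetween G (A ─ B) (∁ (A ∪ B)) ∣ + ∣ Ebetween G (A ∩ B) (B ─ A) ∣ ≤ ∣ δ G A ∣
  diagonal-edges-in-δ = begin
    ∣ ⟦ E₁₄ ⟧ᶜ ∣ + ∣ ⟦ E₂₃ ⟧ᶜ ∣       ≡⟨ ∑∣∣-pair ⟦ E₁₄ ⟧ᶜ ⟦ E₂₃ ⟧ᶜ ⟨
    ∑∣ ⟦ E₁₄ ⟧ᶜ ∷ ⟦ E₂₃ ⟧ᶜ ∷ [] ∣     ≤⟨ ⊑⇒∑∣∣≤ (decide-⊑ (E₁₄ ∷ E₂₃ ∷ []) (δᵗ 𝔸 ∷ []) tt) ⟩
    ∣ δ G A ∣ + 0                     ≡⟨ +-identityʳ ∣ δ G A ∣ ⟩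
    ∣ δ G A ∣                         ∎
    where
    E₁₄ = Eᵗ (𝔸 ─ᵗ 𝔹) (∁ᵗ (𝔸 ∪ᵗ 𝔹))
    E₂₃ = Eᵗ (𝔸 ∩ᵗ 𝔹) (𝔹 ─ᵗ 𝔸)

odd⇒≡1+2*⌊/2⌋ : ∀ {q} → q % 2 ≡ 1 → q ≡ suc (2 * (q / 2))
odd⇒≡1+2*⌊/2⌋ {q} odd = trans (m≡m%n+[m/n]*n q 2) (cong₂ _+_ odd (*-comm (q / 2) 2))

odd≤even⇒< : ∀ {q x} → q % 2 ≡ 1 → q ≤ 2 * x → q < 2 * x
odd≤even⇒< {q} {x} odd q≤2x =
  ≤∧≢⇒< q≤2x (λ q≡2x → even≢odd x (q / 2) (trans (sym q≡2x) (odd⇒≡1+2*⌊/2⌋ odd)))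

odd-split-impossible : ∀ {q} x y → q % 2 ≡ 1 → q ≤ 2 * x → q ≤ 2 * y → ¬ (x + y ≤ q)
odd-split-impossible {q} x y odd q≤2x q≤2y x+y≤q = <-irrefl refl (begin-strict
  2 * q          ≡⟨ cong (q +_) (+-identityʳ q) ⟩
  q + q          <⟨ +-mono-< (odd≤even⇒< {x = x} odd q≤2x) (odd≤even⇒< {x = y} odd q≤2y) ⟩
  2 * x + 2 * y  ≡⟨ *-distribˡ-+ 2 x y ⟨
  2 * (x + y)    ≤⟨ *-monoʳ-≤ 2 x+y≤q ⟩
  2 * q          ∎)
  where open ≤-Reasoning

module _ {n m : ℕ} {G : Graph n m} {p : ℕ} (flex : FlexConnected G p) where

  two-unsafe-cut-edges⇒p+2≤∣δ∣ : ∀ {S e f} → Nonempty S → Nonempty (∁ S) → e ∈ δ G S → f ∈ δ G S →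
                                 e ∈ UnsafeSet G → f ∈ UnsafeSet G → e ≢ f → p + 2 ≤ ∣ δ G S ∣
  two-unsafe-cut-edges⇒p+2≤∣δ∣ {S} {e} {f} S≢∅ ∁S≢∅ e∈δ f∈δ e∈U f∈U e≢f = begin
    p + 2                 ≤⟨ +-monoˡ-≤ 2 (flex F F⊆U ∣F∣≤2 S S≢∅ ∁S≢∅) ⟩
    ∣ δ G S ─ F ∣ + 2     ≡⟨ +-comm _ 2 ⟩
    2 + ∣ δ G S ─ F ∣     ≡⟨ cong (λ D → 2 + ∣ D ∣) (p─q─r≡p─q∪r (δ G S) ⁅ e ⁆ ⁅ f ⁆) ⟨
    2 + ∣ δ G S - e - f ∣ ≤⟨ s≤s (x∈p⇒∣p-x∣<∣p∣ (x∈p∧x≢y⇒x∈p-y f∈δ (e≢f ∘ sym))) ⟩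
    1 + ∣ δ G S - e ∣     ≤⟨ x∈p⇒∣p-x∣<∣p∣ e∈δ ⟩
    ∣ δ G S ∣             ∎
    where
    open ≤-Reasoning
    F = ⁅ e ⁆ ∪ ⁅ f ⁆
    F⊆U : F ⊆ UnsafeSet G
    F⊆U x∈F with x∈p∪q⁻ ⁅ e ⁆ ⁅ f ⁆ x∈F
    ... | inj₁ x∈⁅e⁆ = subst (_∈ UnsafeSet G) (sym (x∈⁅y⁆⇒x≡y e x∈⁅e⁆)) e∈U
    ... | inj₂ x∈⁅f⁆ = subst (_∈ UnsafeSet G) (sym (x∈⁅y⁆⇒x≡y f x∈⁅f⁆)) f∈U
    ∣F∣≤2 : ∣ F ∣ ≤ 2
    ∣F∣≤2 = ≤-trans (∣p∪q∣≤∣p∣+∣q∣ ⁅ e ⁆ ⁅ f ⁆) (≤-reflexive (cong₂ _+_ (∣⁅x⁆∣≡1 e) (∣⁅x⁆∣≡1 f)))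

  disjoint-unsafe-cut-edges⇒p+2≤∣δ∣ : ∀ {S D₁ D₂} → Nonempty S → Nonempty (∁ S) →
    (D₁ ∷ D₂ ∷ []) ⊑ (δ G S ∷ []) → Nonempty (D₁ ∩ UnsafeSet G) → Nonempty (D₂ ∩ UnsafeSet G) →
    p + 2 ≤ ∣ δ G S ∣
  disjoint-unsafe-cut-edges⇒p+2≤∣δ∣ {S} {D₁} {D₂} S≢∅ ∁S≢∅ D⊑δ (e , e∈D₁∩U) (f , f∈D₂∩U) =
    two-unsafe-cut-edges⇒p+2≤∣δ∣ S≢∅ ∁S≢∅ (⊑-pair⇒⊆ˡ D⊑δ e∈D₁) (⊑-pair⇒⊆ʳ D⊑δ f∈D₂) e∈U f∈U
      (λ { refl → ⊑-pair⇒disjoint D⊑δ e∈D₁ f∈D₂ })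
    where
    e∈D₁ = proj₁ (x∈p∩q⁻ D₁ (UnsafeSet G) e∈D₁∩U)
    e∈U  = proj₂ (x∈p∩q⁻ D₁ (UnsafeSet G) e∈D₁∩U)
    f∈D₂ = proj₁ (x∈p∩q⁻ D₂ (UnsafeSet G) f∈D₂∩U)
    f∈U  = proj₂ (x∈p∩q⁻ D₂ (UnsafeSet G) f∈D₂∩U)

  non-amenable-crossing⇒quadrant-cuts : ∀ {A B} →
    Cross G A B → ¬ AmenablyCross G A B → ¬ AmenablyCross G B A →
    p + 2 ≤ ∣ δ G (A ─ B) ∣ × p + 2 ≤ ∣ δ G (A ∩ B) ∣ × p + 2 ≤ ∣ δ G (B ─ A) ∣ × p + 2 ≤ ∣ δ G (∁ (A ∪ B)) ∣
  non-amenable-crossing⇒quadrant-cuts {A} {B} cross@(A─B≢∅ , A∩B≢∅ , B─A≢∅ , ∁A∪B≢∅) ¬amenableAB ¬amenableBA =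
    disjoint-unsafe-cut-edges⇒p+2≤∣δ∣ A─B≢∅ (Nonempty-mono (decide-⊆ (𝔸 ∩ᵗ 𝔹) (∁ᵗ (𝔸 ─ᵗ 𝔹)) tt) A∩B≢∅)
      (decide-⊑ (E₁₂ ∷ E₁₄ ∷ []) (δᵗ (𝔸 ─ᵗ 𝔹) ∷ []) tt) unsafe₁₂ unsafe₁₄ ,
    disjoint-unsafe-cut-edges⇒p+2≤∣δ∣ A∩B≢∅ (Nonempty-mono (decide-⊆ (𝔸 ─ᵗ 𝔹) (∁ᵗ (𝔸 ∩ᵗ 𝔹)) tt) A─B≢∅)
      (decide-⊑ (E₁₂ ∷ E₂₃ ∷ []) (δᵗ (𝔸 ∩ᵗ 𝔹) ∷ []) tt) unsafe₁₂ unsafe₂₃ ,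
    disjoint-unsafe-cut-edges⇒p+2≤∣δ∣ B─A≢∅ (Nonempty-mono (decide-⊆ (𝔸 ∩ᵗ 𝔹) (∁ᵗ (𝔹 ─ᵗ 𝔸)) tt) A∩B≢∅)
      (decide-⊑ (E₂₃ ∷ E₃₄ ∷ []) (δᵗ (𝔹 ─ᵗ 𝔸) ∷ []) tt) unsafe₂₃ unsafe₃₄ ,
    disjoint-unsafe-cut-edges⇒p+2≤∣δ∣ ∁A∪B≢∅ (Nonempty-mono (decide-⊆ (𝔸 ─ᵗ 𝔹) (∁ᵗ (∁ᵗ (𝔸 ∪ᵗ 𝔹))) tt) A─B≢∅)
      (decide-⊑ (E₁₄ ∷ E₃₄ ∷ []) (δᵗ (∁ᵗ (𝔸 ∪ᵗ 𝔹)) ∷ []) tt) unsafe₁₄ unsafe₃₄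
    where
    open VennCuts G A B
    E₁₂ E₁₄ E₂₃ E₃₄ : CutTerm
    E₁₂ = Eᵗ (𝔹 ∩ᵗ 𝔸) (𝔸 ─ᵗ 𝔹)
    E₁₄ = Eᵗ (𝔸 ─ᵗ 𝔹) (∁ᵗ (𝔸 ∪ᵗ 𝔹))
    E₂₃ = Eᵗ (𝔸 ∩ᵗ 𝔹) (𝔹 ─ᵗ 𝔸)
    E₃₄ = Eᵗ (𝔹 ─ᵗ 𝔸) (∁ᵗ (𝔹 ∪ᵗ 𝔸))

    unsafe-edge : ∀ c → ¬ Empty (⟦ c ⟧ᶜ ∩ UnsafeSet G) → Nonempty (⟦ c ⟧ᶜ ∩ UnsafeSet G)
    unsafe-edge c = decidable-stable (nonempty? (⟦ c ⟧ᶜ ∩ UnsafeSet G))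

    unsafe₁₂ = unsafe-edge E₁₂ λ E₁₂∩U≡∅ → ¬amenableBA (Cross-sym G cross , inj₁ E₁₂∩U≡∅)
    unsafe₁₄ = unsafe-edge E₁₄ λ E₁₄∩U≡∅ → ¬amenableAB (cross , inj₂ E₁₄∩U≡∅)
    unsafe₂₃ = unsafe-edge E₂₃ λ E₂₃∩U≡∅ → ¬amenableAB (cross , inj₁ E₂₃∩U≡∅)
    unsafe₃₄ = unsafe-edge E₃₄ λ E₃₄∩U≡∅ → ¬amenableBA (Cross-sym G cross , inj₂ E₃₄∩U≡∅)

  crossing-violated-sets-cross-amenably : ∀ {A B} → p % 2 ≡ 1 → Violated G p A → Violated G p B →
    Cross G A B → ¬ AmenablyCross G A B → ¬ AmenablyCross G B A → ⊥
  crossing-violated-sets-cross-amenably {A} {B} odd (∣δA∣≡p+2 , _) (∣δB∣≡p+2 , _) cross ¬amenableAB ¬amenableBA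
    with non-amenable-crossing⇒quadrant-cuts cross ¬amenableAB ¬amenableBA
  ... | δ₁ , δ₂ , δ₃ , δ₄ =
    odd-split-impossible ∣ E₁₄ ∣ ∣ E₂₃ ∣ (trans ([m+kn]%n≡m%n p 1 2) odd)
      (twice-between ∣ E₁₄ ∣ δ₄ δ₁ (quadrant-cuts-outside G A B))
      (twice-between ∣ E₂₃ ∣ δ₂ δ₃ (quadrant-cuts-inside G A B))
      (subst (∣ E₁₄ ∣ + ∣ E₂₃ ∣ ≤_) ∣δA∣≡p+2 (diagonal-edges-in-δ G A B))
    where
    open ≤-Reasoning
    E₁₄ = Ebetween G (A ─ B) (∁ (A ∪ B))
    E₂₃ = Ebetween G (A ∩ B) (B ─ A)
    twice-between : ∀ {a b} x → p + 2 ≤ a → p + 2 ≤ b → a + b ≤ ∣ δ G B ∣ + 2 * x → p + 2 ≤ 2 * x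
    twice-between {a} {b} x p+2≤a p+2≤b a+b≤ = +-cancelˡ-≤ (p + 2) _ _ (begin
      (p + 2) + (p + 2)  ≤⟨ +-mono-≤ p+2≤a p+2≤b ⟩
      a + b              ≤⟨ a+b≤ ⟩
      ∣ δ G B ∣ + 2 * x  ≡⟨ cong (_+ 2 * x) ∣δB∣≡p+2 ⟩
      (p + 2) + 2 * x    ∎)

  F₂-noncrossing : ∀ {A B} → p % 2 ≡ 1 → F₂ G p A → F₂ G p B → ¬ Cross G A B
  F₂-noncrossing {A} {B} odd (violatedA , ¬F₁A) (violatedB , ¬F₁B) cross =
    crossing-violated-sets-cross-amenably odd violatedA violatedB cross
      (λ amenable → ¬F₁A (violatedA , inj₂ (B , violatedB , amenable)))
      (λ amenable → ¬F₁B (violatedB , inj₂ (A , violatedA , amenable)))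

lemma7 : {n m : ℕ} (p : ℕ) → 3 ≤ p → p % 2 ≡ 1 → (G : Graph n m) →
    FlexConnected G p → Uncrossable (F₂ G p)
lemma7 p _ odd G flex = noncrossing⇒uncrossable G (F₂-∁ G) (F₂-noncrossing flex odd)
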